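{- For all $1<k\le\omega$, the oriented graph $k\cdot(\mathbb{Q},<)$ is not polymorphism homogeneous.
   Context: An oriented graph is a pair $\Gamma=(V,E)$ with $V$ a non-empty set and $E\subseteq V^2$ an asymmetric relation. $(\mathbb{Q},<)$ is the oriented graph on the rationals with an arc $x\to y$ iff $x<y$. $k\cdot\Delta$ denotes the oriented graph that is the disjoint union of $k$ copies of $\Delta$ with no arcs between copies. A homomorphism is an arc-preserving map; an oriented graph is homomorphism homogeneous if every homomorphism between finite induced subgraphs extends to an endomorphism. The $n$-th direct power $\Gamma^n$ has vertex set $V^n$ and arcs $((v_i)_i,(w_i)_i)$ with $(v_i,w_i)\in E$ for all $i$; $\Gamma$ is polymorphism homogeneous if $\Gamma^n$ is homomorphism homogeneous for all $n\ge1$. $\omega$ is the first infinite cardinal. -}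

module Defs where

open import Data.Nat using (ℕ)
open import Data.Product using (_×_; Σ-syntax; _,_)
open import Data.Rational using (ℚ) renaming (_<_ to _<ℚ_)
open import Data.List using (List)
open import Data.List.Membership.Propositional using (_∈_)
open import Data.Vec using (Vec)
open import Data.Vec.Relation.Binary.Pointwise.Inductive using (Pointwise)
open import Relation.Binary.PropositionalEquality using (_≡_; _≢_)
open import Relation.Nullary using (¬_)

record OrientedGraph : Set₁ where
  field
    V     : Set
    E     : V → V → Set
    asym  : ∀ {u v} → E u v → ¬ E v u
    point : V

open OrientedGraph public

-- Homomorphism between the finite induced subgraphs on the vertex lists
-- xs and ys, represented by a function f : V → V whose values on xs matter.
IsFinHom : (Γ : OrientedGraph) → List (V Γ) → List (V Γ) → (V Γ → V Γ) → Set
IsFinHom Γ xs ys f =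
  (∀ u → u ∈ xs → f u ∈ ys) ×
  (∀ u v → u ∈ xs → v ∈ xs → E Γ u v → E Γ (f u) (f v))

IsEndo : (Γ : OrientedGraph) → (V Γ → V Γ) → Set
IsEndo Γ g = ∀ u v → E Γ u v → E Γ (g u) (g v)

HomHomogeneous : OrientedGraph → Set
HomHomogeneous Γ =
  ∀ (xs ys : List (V Γ)) (f : V Γ → V Γ) → IsFinHom Γ xs ys f →
  Σ[ g ∈ (V Γ → V Γ) ] (IsEndo Γ g × (∀ u → u ∈ xs → g u ≡ f u))

-- n-th direct power.
-- (only for n ≥ 1, written as suc m; Γ^0 has a loop, so is not oriented)
power-asym : (Γ : OrientedGraph) (m : ℕ) {u v : Vec (V Γ) (ℕ.suc m)} →
             Pointwise (E Γ) u v → ¬ Pointwise (E Γ) v u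
power-asym Γ m (p Pointwise.∷ ps) (q Pointwise.∷ qs) = asym Γ p q

_^ᵍ_ : OrientedGraph → ℕ → OrientedGraph
Γ ^ᵍ m = record
  { V = Vec (V Γ) (ℕ.suc m)
  ; E = Pointwise (E Γ)
  ; asym = power-asym Γ m
  ; point = Data.Vec.replicate (ℕ.suc m) (point Γ)
  }

PolymorphismHomogeneous : OrientedGraph → Set
PolymorphismHomogeneous Γ = ∀ (m : ℕ) → HomHomogeneous (Γ ^ᵍ m)

open import Data.Rational.Properties using (<-asym)

copiesQ : (C : Set) → C → OrientedGraph
copiesQ C c₀ = record
  { V = C × ℚ
  ; E = λ { (i , x) (j , y) → (i ≡ j) × (x <ℚ y) }
  ; asym = λ { (_ , p) (_ , q) → <-asym p q }
  ; point = c₀ , Data.Rational.0ℚ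
  }

{-# OPTIONS --safe #-}
-- In the square of k·(ℚ,<), the vertices u = (½,1) and v = (1,½) of one copy are
-- incomparable but have the common in-neighbour w = (0,0). Since {u, v} carries no
-- arcs, the map fixing u and sending v into another copy is a homomorphism between
-- finite induced subgraphs. An endomorphism extending it would map w to a common
-- in-neighbour of vertices in two different copies, and arcs never leave a copy.
module Submission where

open import Defs
open import Data.Nat using (ℕ; _+_)
open import Data.Fin as Fin using (Fin; zero)
open import Data.Product using (_×_; _,_; proj₁; proj₂)
open import Data.Empty using (⊥-elim)
open import Data.Unit using (tt)
open import Data.Vec using (_∷_; []; head)
open import Data.Vec.Relation.Binary.Pointwise.Inductive using (_∷_; [])
open import Data.List using (List; _∷_; []; map)
open import Data.List.Membership.Propositional using (_∈_)
open import Data.List.Membership.Propositional.Properties using (∈-map⁺)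
open import Data.List.Relation.Unary.Any using (here; there)
open import Data.Rational using (0ℚ; 1ℚ; ½; _≟_) renaming (_<_ to _<ℚ_)
open import Data.Rational.Properties using (_<?_; <-asym)
open import Function using (_∘′_)
open import Relation.Nullary using (¬_; yes; no)
open import Relation.Nullary.Decidable using (toWitness)
open import Relation.Binary.PropositionalEquality using (_≡_; refl; _≢_; sym; trans; subst)

module _ (Δ : OrientedGraph) where

  Independent : List (V Δ) → Set
  Independent xs = ∀ a b → a ∈ xs → b ∈ xs → ¬ E Δ a b

  NoCommonInNeighbour : V Δ → V Δ → Set
  NoCommonInNeighbour a b = ∀ w → E Δ w a → ¬ E Δ w b

  independent⇒finHom : ∀ {xs} (f : V Δ → V Δ) → Independent xs → IsFinHom Δ xs (map f xs) f
  independent⇒finHom f indep =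
    (λ _ → ∈-map⁺ f) , λ a b a∈xs b∈xs a→b → ⊥-elim (indep a b a∈xs b∈xs a→b)

  incomparable⇒independent : ∀ {u v} → ¬ E Δ u v → ¬ E Δ v u → Independent (u ∷ v ∷ [])
  incomparable⇒independent _   _   _ _ (here refl)         (here refl)         a→a = asym Δ a→a a→a
  incomparable⇒independent u↛v _   _ _ (here refl)         (there (here refl))     = u↛v
  incomparable⇒independent _   v↛u _ _ (there (here refl)) (here refl)             = v↛u
  incomparable⇒independent _   _   _ _ (there (here refl)) (there (here refl)) a→a = asym Δ a→a a→a

  ¬homHomogeneous : ∀ {u v w} (f : V Δ → V Δ) → ¬ E Δ u v → ¬ E Δ v u →
                    E Δ w u → E Δ w v → NoCommonInNeighbour (f u) (f v) → ¬ HomHomogeneous Δ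
  ¬homHomogeneous {u} {v} {w} f u↛v v↛u w→u w→v separated homHom
    with homHom (u ∷ v ∷ []) (map f (u ∷ v ∷ [])) f
                (independent⇒finHom f (incomparable⇒independent u↛v v↛u))
  ... | g , endo , extends =
    separated (g w) (arcTo u (here refl) w→u) (arcTo v (there (here refl)) w→v)
    where
    arcTo : ∀ x → x ∈ u ∷ v ∷ [] → E Δ w x → E Δ (g w) (f x)
    arcTo x x∈xs w→x = subst (E Δ (g w)) (extends x x∈xs) (endo w x w→x)

module _ {C : Set} {c : C} where

  copy : ∀ {m} → V (copiesQ C c ^ᵍ m) → C
  copy = proj₁ ∘′ head

  arc⇒sameCopy : ∀ {m a b} → E (copiesQ C c ^ᵍ m) a b → copy a ≡ copy b
  arc⇒sameCopy ((same , _) ∷ _) = same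

  differentCopies⇒noCommonInNeighbour : ∀ {m a b} → copy a ≢ copy b →
                                        NoCommonInNeighbour (copiesQ C c ^ᵍ m) a b
  differentCopies⇒noCommonInNeighbour copy≢ w w→a w→b =
    copy≢ (trans (sym (arc⇒sameCopy w→a)) (arc⇒sameCopy w→b))

0<½ : 0ℚ <ℚ ½
0<½ = toWitness {a? = 0ℚ <? ½} tt

0<1 : 0ℚ <ℚ 1ℚ
0<1 = toWitness {a? = 0ℚ <? 1ℚ} tt

½<1 : ½ <ℚ 1ℚ
½<1 = toWitness {a? = ½ <? 1ℚ} tt

module _ {C : Set} {c c₀ c₁ : C} (c₀≢c₁ : c₀ ≢ c₁) where

  private
    Γ² : OrientedGraph
    Γ² = copiesQ C c ^ᵍ 1

    w u v v′ : V Γ²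
    w  = (c₀ , 0ℚ) ∷ (c₀ , 0ℚ) ∷ []
    u  = (c₀ , ½)  ∷ (c₀ , 1ℚ) ∷ []
    v  = (c₀ , 1ℚ) ∷ (c₀ , ½)  ∷ []
    v′ = (c₁ , 0ℚ) ∷ (c₁ , 0ℚ) ∷ []

    moveV : V Γ² → V Γ²
    moveV z with proj₂ (head z) ≟ ½
    ... | yes _ = u
    ... | no  _ = v′

    u↛v : ¬ E Γ² u v
    u↛v (_ ∷ (_ , 1<½) ∷ []) = <-asym ½<1 1<½

    v↛u : ¬ E Γ² v u
    v↛u ((_ , 1<½) ∷ _) = <-asym ½<1 1<½

  copiesQ²-¬homHomogeneous : ¬ HomHomogeneous (copiesQ C c ^ᵍ 1)
  copiesQ²-¬homHomogeneous =
    ¬homHomogeneous Γ² moveV u↛v v↛u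
      ((refl , 0<½) ∷ (refl , 0<1) ∷ []) ((refl , 0<1) ∷ (refl , 0<½) ∷ [])
      (differentCopies⇒noCommonInNeighbour {c = c} c₀≢c₁)

  copiesQ-¬polymorphismHomogeneous : ¬ PolymorphismHomogeneous (copiesQ C c)
  copiesQ-¬polymorphismHomogeneous polyHom = copiesQ²-¬homHomogeneous (polyHom 1)

lemma5p2 : ((j : ℕ) → ¬ PolymorphismHomogeneous (copiesQ (Fin (2 + j)) zero))
             × ¬ PolymorphismHomogeneous (copiesQ ℕ 0)
lemma5p2 = (λ j → copiesQ-¬polymorphismHomogeneous {c = zero} {c₀ = zero} {c₁ = Fin.suc zero} λ ())
         , copiesQ-¬polymorphismHomogeneous {c = 0} {c₀ = 0} {c₁ = 1} λ ()
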